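{- For every $n\geq 3$, the simple cycle $C_n$ on $n$ vertices satisfies: (1) $C_n\in\mathfrak{T}$; (2) $w_\tau(C_n)=3$ if $n$ is divisible by $3$, and $w_\tau(C_n)=4$ otherwise; (3) $W_\tau(C_n)=n+2$.
   Context: All graphs are finite, undirected, without loops or multiple edges. A total coloring of a graph $G$ is an assignment of colors to the vertices and edges of $G$ such that no two adjacent vertices, no two adjacent edges, and no vertex and an edge incident to it receive the same color. For a positive integer $t$, an interval total $t$-coloring of $G$ is a total coloring of $G$ with colors $1,2,\ldots,t$ such that each color $i\in\{1,\ldots,t\}$ is used on at least one vertex or edge, and for each vertex $v$ the set consisting of the color of $v$ and the colors of the edges incident to $v$ consists of $d_G(v)+1$ consecutive integers, where $d_G(v)$ is the degree of $v$. $\mathfrak{T}_t$ denotes the set of graphs having an interval total $t$-coloring, and $\mathfrak{T}=\bigcup_{t\geq 1}\mathfrak{T}_t$. For $G\in\mathfrak{T}$, $w_\tau(G)$ and $W_\tau(G)$ denote the least and the greatest $t$ such that $G\in\mathfrak{T}_t$. -}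

module Defs where

open import Data.Nat using (ℕ; zero; suc; _+_; _≤_; _∸_; _≡ᵇ_)
open import Data.Nat.Properties using ()
open import Data.Fin using (Fin; toℕ)
open import Data.List using (List; map; allFin)
open import Data.Nat.ListAction using (sum)
open import Data.Bool using (Bool; true; false; if_then_else_; _∨_; _∧_; T)
open import Data.Product using (Σ; ∃; ∃-syntax; _×_; _,_)
open import Data.Sum using (_⊎_)
open import Relation.Binary.PropositionalEquality using (_≡_; _≢_)
open import Function.Bundles using (_⇔_)

-- A finite graph on vertex set Fin n, given by a (Boolean) adjacency function.
-- (For the cycle below it is symmetric and irreflexive, i.e. a simple graph.)
AdjRel : ℕ → Set
AdjRel n = Fin n → Fin n → Bool

degree : {n : ℕ} → AdjRel n → Fin n → ℕ
degree {n} adj v = sum (map (λ u → if adj v u then 1 else 0) (allFin n))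

cycleAdj : (n : ℕ) → AdjRel n
cycleAdj n i j =
  (toℕ j ≡ᵇ suc (toℕ i)) ∨ (toℕ i ≡ᵇ suc (toℕ j)) ∨
  ((toℕ i ≡ᵇ 0) ∧ (toℕ j ≡ᵇ (n ∸ 1))) ∨ ((toℕ j ≡ᵇ 0) ∧ (toℕ i ≡ᵇ (n ∸ 1)))

record IntervalTotalColoring {n : ℕ} (adj : AdjRel n) (t : ℕ) : Set where
  field
    α : Fin n → ℕ
    β : Fin n → Fin n → ℕ
    β-sym : ∀ u v → T (adj u v) → β u v ≡ β v u
    α-range : ∀ v → 1 ≤ α v × α v ≤ t
    β-range : ∀ u v → T (adj u v) → 1 ≤ β u v × β u v ≤ t
    adj-vertices : ∀ u v → T (adj u v) → α u ≢ α v
    adj-edges : ∀ u v w → T (adj u v) → T (adj u w) → v ≢ w → β u v ≢ β u w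
    incident : ∀ u v → T (adj u v) → α u ≢ β u v
    surj : ∀ i → 1 ≤ i → i ≤ t →
           (∃[ v ] α v ≡ i) ⊎ (∃[ u ] ∃[ v ] (T (adj u v) × β u v ≡ i))
    interval : ∀ v → ∃[ a ] (∀ x →
      ((x ≡ α v ⊎ ∃[ u ] (T (adj v u) × x ≡ β v u))
        ⇔ (a ≤ x × x ≤ a + degree adj v)))

InT : {n : ℕ} → AdjRel n → ℕ → Set
InT adj t = 1 ≤ t × IntervalTotalColoring adj t

InTAny : {n : ℕ} → AdjRel n → Set
InTAny adj = ∃[ t ] InT adj t

IsMinT : {n : ℕ} → AdjRel n → ℕ → Set
IsMinT adj m = InT adj m × (∀ t → InT adj t → m ≤ t)

IsMaxT : {n : ℕ} → AdjRel n → ℕ → Set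
IsMaxT adj m = InT adj m × (∀ t → InT adj t → t ≤ m)

-- A vertex of the cycle sees three distinct colours, so t ≥ 3.  If t = 3, every vertex sees exactly
-- the colours 1, 2, 3; then along the cycle each colour is forced by the two before it, the vertex
-- colours repeat with period 3, and 3 divides n.  For the upper bound, let a_v be the least colour at
-- vertex v.  Shared edge colours make neighbouring values a_v differ by at most 2, and a vertex cannot
-- lie 2 below both neighbours (both its edges would get the same colour).  Running from a vertex with
-- a_v ≤ 1 to a vertex holding colour t along both arcs of the cycle, at least one arc starts with a
-- step of at most 1, and adding the two estimates gives t ≤ n + 2.  All three bounds are attained by
-- explicit periodic patterns of colours read along the cycle.

module Submission where

open import Defs
open import Data.Nat using (ℕ; zero; suc; _+_; _*_; _∸_; _≤_; _<_; _≡ᵇ_; _≤ᵇ_; z≤n; s≤s; NonZero)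
open import Data.Nat.Properties
open import Data.Nat.Tactic.RingSolver using (solve-∀)
open import Data.Nat.Divisibility using (_∣_; divides; m%n≡0⇒n∣m)
open import Data.Nat.DivMod using (_%_; _/_; m≡m%n+[m/n]*n; _mod_; m%n<n; n%n≡0; m<n⇒m%n≡m; %-distribˡ-+; [m+n]%n≡m%n)
open import Data.Fin as Fin using (Fin; toℕ; #_; fromℕ; fromℕ<; inject₁)
open import Data.Fin.Patterns using (0F; 1F; 2F; 3F)
open import Data.Fin.Properties using (toℕ-injective; toℕ-fromℕ<; toℕ-fromℕ; toℕ-inject₁; toℕ<n; pigeonhole)
open import Data.List using (map; allFin; tabulate)
open import Data.List.Properties using (map-tabulate; tabulate-cong)
open import Data.Nat.ListAction using (sum)
open import Data.Vec.Functional using ([]; _∷_)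
open import Data.Bool using (true; false; if_then_else_; _∧_; T)
open import Data.Bool.Properties using (T-∨; T-∧)
open import Data.Product using (∃₂; ∃-syntax; _×_; _,_; proj₁; proj₂)
open import Data.Sum using (_⊎_; inj₁; inj₂; [_,_]; [_,_]′; map₂; swap)
open import Data.Empty using (⊥; ⊥-elim)
open import Data.Unit using (tt)
open import Relation.Nullary using (¬_; yes; no; does)
open import Relation.Binary.Definitions using (tri<; tri≈; tri>)
open import Relation.Binary.PropositionalEquality using (_≡_; _≢_; refl; sym; trans; cong; cong₂; subst; subst₂; module ≡-Reasoning)
open import Function using (id; _∘_)
open import Algebra.Properties.CommutativeSemigroup +-commutativeSemigroup using (interchange)
open import Function.Bundles using (_⇔_; mk⇔; Equivalence)

twice : ∀ n → 2 * n ≡ n + n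
twice n = cong (n +_) (+-identityʳ n)

offset≤ : ∀ {lo w x} → x ≤ lo + w → x ∸ lo ≤ w
offset≤ {lo} {w} {x} x≤ = subst (x ∸ lo ≤_) (m+n∸m≡n lo w) (∸-monoˡ-≤ lo x≤)

window-pigeonhole : ∀ {n lo w} (v : Fin n → ℕ) → suc w < n →
                    (∀ k → lo ≤ v k × v k ≤ lo + w) → ∃₂ λ i j → i Fin.< j × v i ≡ v j
window-pigeonhole v w<n bounds
  with i , j , i<j , same ← pigeonhole w<n (λ k → fromℕ< (s≤s (offset≤ (proj₂ (bounds k)))))
  = i , j , i<j , ∸-cancelʳ-≡ (proj₁ (bounds i)) (proj₁ (bounds j))
                    (trans (sym (toℕ-fromℕ< _)) (trans (cong toℕ same) (toℕ-fromℕ< _)))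

InWindow : ℕ → ℕ → Set
InWindow lo x = lo ≤ x × x ≤ lo + 2

no-four-in-window : ∀ {lo x y z u} → InWindow lo x → InWindow lo y → InWindow lo z → InWindow lo u →
                    x ≢ y → x ≢ z → x ≢ u → y ≢ z → y ≢ u → z ≢ u → ⊥
no-four-in-window {x = x} {y} {z} {u} x∈ y∈ z∈ u∈ x≢y x≢z x≢u y≢z y≢u z≢u
  with window-pigeonhole (x ∷ y ∷ z ∷ u ∷ []) ≤-refl bounds
  where
  bounds : ∀ k → InWindow _ ((x ∷ y ∷ z ∷ u ∷ []) k)
  bounds 0F = x∈
  bounds (1F) = y∈
  bounds (2F) = z∈
  bounds (3F) = u∈
... | 0F , 1F , _ , same = x≢y same
... | 0F , 2F , _ , same = x≢z same
... | 0F , 3F , _ , same = x≢u same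
... | 1F , 2F , _ , same = y≢z same
... | 1F , 3F , _ , same = y≢u same
... | 2F , 3F , _ , same = z≢u same
... | _ , 0F , () , _
... | 1F , 1F , s≤s () , _
... | Fin.suc (Fin.suc _) , 1F , s≤s () , _
... | 2F , 2F , s≤s (s≤s ()) , _
... | Fin.suc (Fin.suc (Fin.suc _)) , 2F , s≤s (s≤s ()) , _
... | 3F , 3F , s≤s (s≤s (s≤s ())) , _

record Consecutive₃ (x y z : ℕ) : Set where
  field
    base : ℕ
    x∈ : InWindow base x
    y∈ : InWindow base y
    z∈ : InWindow base z
    x≢y : x ≢ y
    x≢z : x ≢ z
    y≢z : y ≢ z

  covers : ∀ {u} → InWindow base u → u ≡ x ⊎ u ≡ y ⊎ u ≡ z
  covers {u} u∈ with u ≟ x | u ≟ y | u ≟ z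
  ... | yes u≡x | _ | _ = inj₁ u≡x
  ... | no _ | yes u≡y | _ = inj₂ (inj₁ u≡y)
  ... | no _ | no _ | yes u≡z = inj₂ (inj₂ u≡z)
  ... | no u≢x | no u≢y | no u≢z =
    ⊥-elim (no-four-in-window x∈ y∈ z∈ u∈ x≢y x≢z (u≢x ∘ sym) y≢z (u≢y ∘ sym) (u≢z ∘ sym))

consecutive : ∀ lo {x y z} (i j k : Fin 3) → x ≡ toℕ i + lo → y ≡ toℕ j + lo → z ≡ toℕ k + lo →
              i ≢ j → i ≢ k → j ≢ k → Consecutive₃ x y z
consecutive lo i j k refl refl refl i≢j i≢k j≢k = record
  { base = lo ; x∈ = offset i ; y∈ = offset j ; z∈ = offset k
  ; x≢y = i≢j ∘ cancel ; x≢z = i≢k ∘ cancel ; y≢z = j≢k ∘ cancel }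
  where
  offset : ∀ i → InWindow lo (toℕ i + lo)
  offset i = m≤n+m lo (toℕ i) , subst (toℕ i + lo ≤_) (+-comm 2 lo) (+-monoˡ-≤ lo (≤-pred (toℕ<n i)))
  cancel : ∀ {i j : Fin 3} → toℕ i + lo ≡ toℕ j + lo → i ≡ j
  cancel = toℕ-injective ∘ +-cancelʳ-≡ lo _ _

three-distinct⇒3≤t : ∀ {t x y z} → 1 ≤ x × x ≤ t → 1 ≤ y × y ≤ t → 1 ≤ z × z ≤ t →
                       x ≢ y → x ≢ z → y ≢ z → 3 ≤ t
three-distinct⇒3≤t {t} (1≤x , x≤t) (1≤y , y≤t) (1≤z , z≤t) x≢y x≢z y≢z with 3 ≤? t
... | yes 3≤t = 3≤t
... | no 3≰t = ⊥-elim (no-four-in-window (1≤x , bound x≤t) (1≤y , bound y≤t) (1≤z , bound z≤t)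
                                         (s≤s z≤n , ≤-refl) x≢y x≢z (≢3 x≤t) y≢z (≢3 y≤t) (≢3 z≤t))
  where
  t≤2 : t ≤ 2
  t≤2 = ≤-pred (≰⇒> 3≰t)
  bound : ∀ {c} → c ≤ t → c ≤ 3
  bound c≤t = ≤-trans c≤t (≤-trans t≤2 (n≤1+n 2))
  ≢3 : ∀ {c} → c ≤ t → c ≢ 3
  ≢3 c≤t refl = 3≰t c≤t

forced-colour : ∀ {x y z u} → InWindow 1 x → InWindow 1 y → InWindow 1 z → InWindow 1 u →
                x ≢ y → x ≢ z → y ≢ z → u ≢ y → u ≢ z → u ≡ x
forced-colour x∈ y∈ z∈ u∈ x≢y x≢z y≢z u≢y u≢z
  with Consecutive₃.covers
         (record { base = 1 ; x∈ = x∈ ; y∈ = y∈ ; z∈ = z∈ ; x≢y = x≢y ; x≢z = x≢z ; y≢z = y≢z }) u∈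
... | inj₁ u≡x = u≡x
... | inj₂ (inj₁ u≡y) = ⊥-elim (u≢y u≡y)
... | inj₂ (inj₂ u≡z) = ⊥-elim (u≢z u≡z)

δ : ∀ {n} → Fin n → Fin n → ℕ
δ x u = if does (u Fin.≟ x) then 1 else 0

sum-zeros : ∀ n → sum (tabulate {n = n} (λ _ → 0)) ≡ 0
sum-zeros zero = refl
sum-zeros (suc n) = sum-zeros n

sum-δ : ∀ {n} (x : Fin n) → sum (tabulate (δ x)) ≡ 1
sum-δ {suc n} Fin.zero = cong suc (sum-zeros n)
sum-δ (Fin.suc x) = sum-δ x

sum-tabulate-+ : ∀ {n} (f g : Fin n → ℕ) →
                 sum (tabulate (λ u → f u + g u)) ≡ sum (tabulate f) + sum (tabulate g)
sum-tabulate-+ {zero} f g = refl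
sum-tabulate-+ {suc n} f g =
  trans (cong (f Fin.zero + g Fin.zero +_) (sum-tabulate-+ (f ∘ Fin.suc) (g ∘ Fin.suc)))
        (interchange (f Fin.zero) (g Fin.zero) _ _)

degree-two : ∀ {n} (adj : AdjRel n) v {x y} → x ≢ y → (∀ u → T (adj v u) ⇔ (u ≡ x ⊎ u ≡ y)) →
             degree adj v ≡ 2
degree-two {n} adj v {x} {y} x≢y neighbours = begin
  sum (map indicator (allFin n))                       ≡⟨ cong sum (map-tabulate {n = n} id indicator) ⟩
  sum (tabulate indicator)                             ≡⟨ cong sum (tabulate-cong split) ⟩
  sum (tabulate (λ u → δ x u + δ y u))                 ≡⟨ sum-tabulate-+ (δ x) (δ y) ⟩
  sum (tabulate (δ x)) + sum (tabulate (δ y))          ≡⟨ cong₂ _+_ (sum-δ x) (sum-δ y) ⟩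
  2                                                    ∎
  where
  open ≡-Reasoning
  indicator : Fin n → ℕ
  indicator u = if adj v u then 1 else 0
  split : ∀ u → indicator u ≡ δ x u + δ y u
  split u with adj v u in adj≡ | u Fin.≟ x | u Fin.≟ y
  ... | _ | yes refl | yes refl = ⊥-elim (x≢y refl)
  ... | true | yes _ | no _ = refl
  ... | true | no _ | yes _ = refl
  ... | true | no u≢x | no u≢y = ⊥-elim ([ u≢x , u≢y ] (Equivalence.to (neighbours u) (subst T (sym adj≡) tt)))
  ... | false | yes u≡x | no _ = ⊥-elim (subst T adj≡ (Equivalence.from (neighbours u) (inj₁ u≡x)))
  ... | false | no _ | yes u≡y = ⊥-elim (subst T adj≡ (Equivalence.from (neighbours u) (inj₂ u≡y)))
  ... | false | no _ | no _ = refl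

periodic-mod : ∀ {f : ℕ → ℕ} k .{{_ : NonZero k}} → (∀ i → f (k + i) ≡ f i) → ∀ i → f i ≡ f (i % k)
periodic-mod {f} k period i = trans (cong f (m≡m%n+[m/n]*n i k)) (shift (i % k) (i / k))
  where
  shift : ∀ r q → f (r + q * k) ≡ f r
  shift r zero = cong f (+-identityʳ r)
  shift r (suc q) = trans (cong f (+-comm-middle r k (q * k))) (trans (period _) (shift r q))
    where +-comm-middle : ∀ x y z → x + (y + z) ≡ y + (x + z)
          +-comm-middle = solve-∀

average-bound : ∀ {x y} j k → y ≤ 2 * j + x → y ≤ suc (2 * k + x) → y < suc (j + k) + x
average-bound {x} {y} j k y≤ y≤′ = *-cancelˡ-< 2 y (suc (j + k) + x) (begin-strict
  2 * y                              ≡⟨ twice y ⟩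
  y + y                              ≤⟨ +-mono-≤ y≤ y≤′ ⟩
  2 * j + x + suc (2 * k + x)        <⟨ n<1+n _ ⟩
  suc (2 * j + x + suc (2 * k + x))  ≡⟨ regroup j k x ⟩
  2 * (suc (j + k) + x)              ∎)
  where
  open ≤-Reasoning
  regroup : ∀ j k x → suc (2 * j + x + suc (2 * k + x)) ≡ 2 * (suc (j + k) + x)
  regroup = solve-∀

module Oscillation {n : ℕ} (a : ℕ → ℕ)
  (rise : ∀ i → a (suc i) ≤ 2 + a i)
  (fall : ∀ i → a i ≤ 2 + a (suc i))
  (no-valley : ∀ i → a i ≡ 2 + a (suc i) → a (suc (suc i)) ≢ 2 + a (suc i))
  (periodic : ∀ i → a (i + n) ≡ a i) where

  ascent : ∀ i k → a (i + k) ≤ 2 * k + a i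
  ascent i zero = ≤-reflexive (cong a (+-identityʳ i))
  ascent i (suc k) = begin
    a (i + suc k)        ≡⟨ cong a (+-suc i k) ⟩
    a (suc (i + k))      ≤⟨ rise (i + k) ⟩
    2 + a (i + k)        ≤⟨ +-monoʳ-≤ 2 (ascent i k) ⟩
    2 + (2 * k + a i)    ≡⟨ shuffle k (a i) ⟩
    2 * suc k + a i      ∎
    where
    open ≤-Reasoning
    shuffle : ∀ k x → 2 + (2 * k + x) ≡ 2 * suc k + x
    shuffle = solve-∀

  descent : ∀ i k → a i ≤ 2 * k + a (i + k)
  descent i zero = ≤-reflexive (cong a (sym (+-identityʳ i)))
  descent i (suc k) = begin
    a i                        ≤⟨ descent i k ⟩
    2 * k + a (i + k)          ≤⟨ +-monoʳ-≤ (2 * k) (fall (i + k)) ⟩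
    2 * k + (2 + a (suc (i + k))) ≡⟨ cong (λ j → 2 * k + (2 + a j)) (sym (+-suc i k)) ⟩
    2 * k + (2 + a (i + suc k))   ≡⟨ shuffle k (a (i + suc k)) ⟩
    2 * suc k + a (i + suc k)     ∎
    where
    open ≤-Reasoning
    shuffle : ∀ k x → 2 * k + (2 + x) ≡ 2 * suc k + x
    shuffle = solve-∀

  -- p + k is the other neighbour of p, i.e. p − 1 modulo n
  gentle-side : ∀ p k → n ≡ suc k → a (suc p) ≤ suc (a p) ⊎ a (p + k) ≤ suc (a p)
  gentle-side p k n≡1+k with a (suc p) ≤? suc (a p)
  ... | yes gentle = inj₁ gentle
  ... | no steep = inj₂ (≤-pred (≤∧≢⇒< (subst (λ b → a (p + k) ≤ 2 + b) back (fall (p + k))) not-steep))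
    where
    back : a (suc (p + k)) ≡ a p
    back = trans (cong a (trans (sym (+-suc p k)) (cong (p +_) (sym n≡1+k)))) (periodic p)
    up : a (suc p) ≡ 2 + a p
    up = ≤-antisym (rise p) (≰⇒> steep)
    not-steep : a (p + k) ≢ 2 + a p
    not-steep eq = no-valley (p + k) (trans eq (cong (2 +_) (sym back)))
      (begin
        a (suc (suc (p + k)))  ≡⟨ cong (a ∘ suc) (trans (sym (+-suc p k)) (cong (p +_) (sym n≡1+k))) ⟩
        a (suc (p + n))        ≡⟨ periodic (suc p) ⟩
        a (suc p)              ≡⟨ up ⟩
        2 + a p                ≡⟨ cong (2 +_) back ⟨
        2 + a (suc (p + k))    ∎)
      where open ≡-Reasoning

  -- Bound a (p + d) along both arcs from p; on the side where p's neighbour is at most one higher the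
  -- bound is one better, and averaging the two bounds gives the strict inequality.
  within : ∀ p d → d < n → a (p + d) < n + a p
  within p zero 0<n = subst (_< n + a p) (cong a (sym (+-identityʳ p))) (m<n+m (a p) 0<n)
  within p (suc d) d<n with o , refl ← m≤n⇒∃[o]m+o≡n d<n with gentle-side p (suc (d + o)) refl
  ... | inj₁ gentle = subst (λ s → a (p + suc d) < suc (suc s) + a p) (+-comm o d) (average-bound (suc o) d
        (begin
          a (p + suc d)                ≤⟨ descent (p + suc d) (suc o) ⟩
          2 * suc o + a (p + suc d + suc o) ≡⟨ cong (λ i → 2 * suc o + a i) (wrap p d o) ⟩
          2 * suc o + a (p + n)        ≡⟨ cong (2 * suc o +_) (periodic p) ⟩
          2 * suc o + a p              ∎)
        (begin
          a (p + suc d)                ≡⟨ cong a (+-suc p d) ⟩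
          a (suc p + d)                ≤⟨ ascent (suc p) d ⟩
          2 * d + a (suc p)            ≤⟨ +-monoʳ-≤ (2 * d) gentle ⟩
          2 * d + suc (a p)            ≡⟨ +-suc (2 * d) (a p) ⟩
          suc (2 * d + a p)            ∎))
    where
    open ≤-Reasoning
    wrap : ∀ p d o → p + suc d + suc o ≡ p + suc (suc (d + o))
    wrap = solve-∀
  ... | inj₂ gentle = average-bound (suc d) o (ascent p (suc d))
        (begin
          a (p + suc d)                ≤⟨ descent (p + suc d) o ⟩
          2 * o + a (p + suc d + o)    ≡⟨ cong (λ i → 2 * o + a i) (+-assoc p (suc d) o) ⟩
          2 * o + a (p + suc (d + o))  ≤⟨ +-monoʳ-≤ (2 * o) gentle ⟩
          2 * o + suc (a p)            ≡⟨ +-suc (2 * o) (a p) ⟩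
          suc (2 * o + a p)            ∎)
    where open ≤-Reasoning

  oscillation : ∀ {p q} → p < n → q < n → a q < n + a p
  oscillation {p} {q} p<n q<n with p ≤? q
  ... | yes p≤q with d , refl ← m≤n⇒∃[o]m+o≡n p≤q = within p d (≤-<-trans (m≤n+m d p) q<n)
  ... | no p≰q with r , refl ← m≤n⇒∃[o]m+o≡n p<n =
    subst (_< n + a p) (trans (cong a (rearrange p q r)) (periodic q))
          (within p (q + suc r) (subst (_< suc (p + r)) (sym (+-suc q r)) (s≤s (+-monoˡ-< r (≰⇒> p≰q)))))
    where
    rearrange : ∀ p q r → p + (q + suc r) ≡ q + (suc p + r)
    rearrange = solve-∀

module ThreeColours {A E : ℕ → ℕ}
  (A∈ : ∀ i → InWindow 1 (A i))
  (E∈ : ∀ i → InWindow 1 (E i))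
  (A≢A⁺ : ∀ i → A i ≢ A (suc i))
  (A≢E : ∀ i → A i ≢ E i)
  (E≢A⁺ : ∀ i → E i ≢ A (suc i))
  (E≢E⁺ : ∀ i → E i ≢ E (suc i)) where

  edge-repeats-vertex : ∀ i → E (suc i) ≡ A i
  edge-repeats-vertex i = forced-colour (A∈ i) (E∈ i) (A∈ (suc i)) (E∈ (suc i))
    (A≢E i) (A≢A⁺ i) (E≢A⁺ i) (E≢E⁺ i ∘ sym) (A≢E (suc i) ∘ sym)

  vertex-repeats-edge : ∀ i → A (suc (suc i)) ≡ E i
  vertex-repeats-edge i = forced-colour (E∈ i) (A∈ (suc i)) (E∈ (suc i)) (A∈ (suc (suc i)))
    (E≢A⁺ i) (E≢E⁺ i) (A≢E (suc i)) (A≢A⁺ (suc i) ∘ sym) (E≢A⁺ (suc i) ∘ sym)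

  vertex-period-3 : ∀ i → A (3 + i) ≡ A i
  vertex-period-3 i = trans (vertex-repeats-edge (suc i)) (edge-repeats-vertex i)

  3∣period : ∀ {n} → (∀ i → A (i + n) ≡ A i) → 3 ∣ n
  3∣period {n} periodic with n % 3 in n%3 | m%n<n n 3 | trans (sym (periodic 0)) (periodic-mod 3 vertex-period-3 n)
  ... | 0 | _ | _ = m%n≡0⇒n∣m n 3 n%3
  ... | 1 | _ | A₀≡A₁ = ⊥-elim (A≢A⁺ 0 A₀≡A₁)
  ... | 2 | _ | A₀≡A₂ = ⊥-elim (A≢E 0 (trans A₀≡A₂ (vertex-repeats-edge 0)))
  ... | suc (suc (suc _)) | s≤s (s≤s (s≤s ())) | _

-- A colouring of a cycle read along its vertices: A i colours vertex i and E i the edge {i, i + 1}.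
Link : (A E : ℕ → ℕ) → ℕ → ℕ → Set
Link A E i j = A i ≢ A j × Consecutive₃ (E i) (A j) (E j)

module Cycle (m : ℕ) where

  N : ℕ
  N = 3 + m

  next : Fin N → Fin N
  next v = suc (toℕ v) mod N

  prev : Fin N → Fin N
  prev Fin.zero = fromℕ (2 + m)
  prev (Fin.suc k) = inject₁ k

  toℕ-next : ∀ v → (suc (toℕ v) < N × toℕ (next v) ≡ suc (toℕ v))
                  ⊎ (toℕ v ≡ 2 + m × toℕ (next v) ≡ 0)
  toℕ-next v with suc (toℕ v) <? N
  ... | yes v+1<N = inj₁ (v+1<N , trans (toℕ-fromℕ< _) (m<n⇒m%n≡m v+1<N))
  ... | no v+1≮N = inj₂ (suc-injective v+1≡N , trans (toℕ-fromℕ< _) (trans (cong (_% N) v+1≡N) (n%n≡0 N)))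
    where
    v+1≡N : suc (toℕ v) ≡ N
    v+1≡N = ≤-antisym (toℕ<n v) (≮⇒≥ v+1≮N)

  next-injective : ∀ {u v} → next u ≡ next v → u ≡ v
  next-injective {u} {v} eq with toℕ-next u | toℕ-next v
  ... | inj₁ (_ , u′) | inj₁ (_ , v′) =
    toℕ-injective (suc-injective (trans (sym u′) (trans (cong toℕ eq) v′)))
  ... | inj₁ (_ , u′) | inj₂ (_ , v′) with () ← trans (sym u′) (trans (cong toℕ eq) v′)
  ... | inj₂ (_ , u′) | inj₁ (_ , v′) with () ← trans (sym v′) (trans (cong toℕ (sym eq)) u′)
  ... | inj₂ (u-last , _) | inj₂ (v-last , _) = toℕ-injective (trans u-last (sym v-last))

  next-prev : ∀ v → next (prev v) ≡ v
  next-prev Fin.zero = toℕ-injective (trans (toℕ-fromℕ< _)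
    (trans (cong (λ k → suc k % N) (toℕ-fromℕ (2 + m))) (n%n≡0 N)))
  next-prev (Fin.suc k) = toℕ-injective (trans (toℕ-fromℕ< _)
    (trans (cong (λ j → suc j % N) (toℕ-inject₁ k)) (m<n⇒m%n≡m (toℕ<n (Fin.suc k)))))

  -- this is where N ≥ 3 is needed
  next²≢id : ∀ v → next (next v) ≢ v
  next²≢id v eq with toℕ-next v
  ... | inj₂ (v-last , v′) with toℕ-next (next v)
  ...   | inj₁ (_ , w′) with () ← trans (sym v-last) (trans (cong toℕ (sym eq)) (trans w′ (cong suc v′)))
  ...   | inj₂ (w-last , _) with () ← trans (sym w-last) v′
  next²≢id v eq | inj₁ (_ , v′) with toℕ-next (next v)
  ...   | inj₁ (_ , w′) = m≢1+n+m (toℕ v) {1} (trans (cong toℕ (sym eq)) (trans w′ (cong suc v′)))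
  ...   | inj₂ (w-last , w′) with () ← trans (sym w-last) (trans v′ (cong suc (trans (cong toℕ (sym eq)) w′)))

  next≢prev : ∀ v → next v ≢ prev v
  next≢prev v eq = next²≢id v (trans (cong next eq) (next-prev v))

  next⇒prev : ∀ {u v} → u ≡ next v → v ≡ prev u
  next⇒prev {u} eq = next-injective (trans (sym eq) (sym (next-prev u)))

  is-next : ∀ {u v} → (toℕ v ≡ suc (toℕ u) ⊎ (toℕ u ≡ 2 + m × toℕ v ≡ 0)) → v ≡ next u
  is-next {u} {v} step with toℕ-next u | step
  ... | inj₁ (_ , u′) | inj₁ v≡1+u = toℕ-injective (trans v≡1+u (sym u′))
  ... | inj₂ (_ , u′) | inj₂ (_ , v≡0) = toℕ-injective (trans v≡0 (sym u′))
  ... | inj₁ (u+1<N , _) | inj₂ (u-last , _) = ⊥-elim (<-irrefl (cong suc u-last) u+1<N)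
  ... | inj₂ (u-last , _) | inj₁ v≡1+u = ⊥-elim (<-irrefl (trans v≡1+u (cong suc u-last)) (toℕ<n v))

  adjacent→ : ∀ u v → T (cycleAdj N u v) → v ≡ next u ⊎ u ≡ next v
  adjacent→ u v adj with Equivalence.to T-∨ adj
  ... | inj₁ j≡1+i = inj₁ (is-next {u} {v} (inj₁ (≡ᵇ⇒≡ _ _ j≡1+i)))
  ... | inj₂ adj′ with Equivalence.to T-∨ adj′
  ...   | inj₁ i≡1+j = inj₂ (is-next {v} {u} (inj₁ (≡ᵇ⇒≡ _ _ i≡1+j)))
  ...   | inj₂ adj″ with Equivalence.to T-∨ adj″
  ...     | inj₁ i≡0∧j≡last with Equivalence.to T-∧ i≡0∧j≡last
  ...       | i≡0 , j≡last = inj₂ (is-next {v} {u} (inj₂ (≡ᵇ⇒≡ _ _ j≡last , ≡ᵇ⇒≡ _ _ i≡0)))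
  adjacent→ u v adj | inj₂ _ | inj₂ _ | inj₂ j≡0∧i≡last with Equivalence.to T-∧ j≡0∧i≡last
  ...       | j≡0 , i≡last = inj₁ (is-next {u} {v} (inj₂ (≡ᵇ⇒≡ _ _ i≡last , ≡ᵇ⇒≡ _ _ j≡0)))

  adjacency-intro : ∀ u v → T (toℕ v ≡ᵇ suc (toℕ u)) ⊎ T (toℕ u ≡ᵇ suc (toℕ v)) ⊎
                    T ((toℕ u ≡ᵇ 0) ∧ (toℕ v ≡ᵇ 2 + m)) ⊎ T ((toℕ v ≡ᵇ 0) ∧ (toℕ u ≡ᵇ 2 + m)) →
                    T (cycleAdj N u v)
  adjacency-intro u v =
    Equivalence.from T-∨ ∘ map₂ (Equivalence.from T-∨ ∘ map₂ (Equivalence.from T-∨))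

  adjacent-next : ∀ v → T (cycleAdj N v (next v))
  adjacent-next v with toℕ-next v
  ... | inj₁ (_ , v′) = adjacency-intro v (next v) (inj₁ (≡⇒≡ᵇ _ _ v′))
  ... | inj₂ (v-last , v′) = adjacency-intro v (next v)
                               (inj₂ (inj₂ (inj₂ (Equivalence.from T-∧ (≡⇒≡ᵇ _ _ v′ , ≡⇒≡ᵇ _ _ v-last)))))

  adjacent-from-next : ∀ v → T (cycleAdj N (next v) v)
  adjacent-from-next v with toℕ-next v
  ... | inj₁ (_ , v′) = adjacency-intro (next v) v (inj₂ (inj₁ (≡⇒≡ᵇ _ _ v′)))
  ... | inj₂ (v-last , v′) = adjacency-intro (next v) v
                               (inj₂ (inj₂ (inj₁ (Equivalence.from T-∧ (≡⇒≡ᵇ _ _ v′ , ≡⇒≡ᵇ _ _ v-last)))))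

  adjacent← : ∀ u v → v ≡ next u ⊎ u ≡ next v → T (cycleAdj N u v)
  adjacent← u _ (inj₁ refl) = adjacent-next u
  adjacent← _ v (inj₂ refl) = adjacent-from-next v

  adjacent-prev : ∀ v → T (cycleAdj N v (prev v))
  adjacent-prev v = adjacent← v (prev v) (inj₂ (sym (next-prev v)))

  degree-cycle : ∀ v → degree (cycleAdj N) v ≡ 2
  degree-cycle v = degree-two (cycleAdj N) v (next≢prev v) λ u →
    mk⇔ (λ adj → map₂ next⇒prev (adjacent→ v u adj))
        (λ { (inj₁ u≡next) → adjacent← v u (inj₁ u≡next)
           ; (inj₂ refl) → adjacent-prev v })

  adjacent-sym : ∀ u v → T (cycleAdj N u v) → T (cycleAdj N v u)
  adjacent-sym u v adj = adjacent← v u (swap (adjacent→ u v adj))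

  mod-suc : ∀ i → suc i mod N ≡ next (i mod N)
  mod-suc i = toℕ-injective (begin
    toℕ (suc i mod N)          ≡⟨ toℕ-fromℕ< _ ⟩
    suc i % N                  ≡⟨ %-distribˡ-+ 1 i N ⟩
    suc (i % N) % N            ≡⟨ cong (λ k → suc k % N) (toℕ-fromℕ< (m%n<n i N)) ⟨
    suc (toℕ (i mod N)) % N    ≡⟨ toℕ-fromℕ< _ ⟨
    toℕ (next (i mod N))       ∎)
    where open ≡-Reasoning

  mod-periodic : ∀ i → (i + N) mod N ≡ i mod N
  mod-periodic i = toℕ-injective (trans (toℕ-fromℕ< _) (trans ([m+n]%n≡m%n i N) (sym (toℕ-fromℕ< _))))

  mod-toℕ : ∀ v → toℕ v mod N ≡ v
  mod-toℕ v = toℕ-injective (trans (toℕ-fromℕ< _) (m<n⇒m%n≡m (toℕ<n v)))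

  around : (P : ℕ → ℕ → Set) → (∀ j → suc j < N → P j (suc j)) → P (2 + m) 0 →
           ∀ v → P (toℕ v) (toℕ (next v))
  around P step wrap v with toℕ-next v
  ... | inj₁ (v+1<N , v′) = subst (P (toℕ v)) (sym v′) (step (toℕ v) v+1<N)
  ... | inj₂ (v-last , v′) = subst₂ P (sym v-last) (sym v′) wrap

  module FromPattern (t : ℕ) (A E : ℕ → ℕ)
    (A-range : ∀ i → i < N → 1 ≤ A i × A i ≤ t)
    (E-range : ∀ i → i < N → 1 ≤ E i × E i ≤ t)
    (links : ∀ v → Link A E (toℕ v) (toℕ (next v)))
    (onto : ∀ c → 1 ≤ c → c ≤ t → ∃[ i ] i < N × (A i ≡ c ⊎ E i ≡ c)) where

    α : Fin N → ℕ
    α v = A (toℕ v)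

    β : Fin N → Fin N → ℕ
    β u v with v Fin.≟ next u
    ... | yes _ = E (toℕ u)
    ... | no _ = E (toℕ v)

    β-next : ∀ v → β v (next v) ≡ E (toℕ v)
    β-next v with next v Fin.≟ next v
    ... | yes _ = refl
    ... | no ≢ = ⊥-elim (≢ refl)

    β-from-next : ∀ v → β (next v) v ≡ E (toℕ v)
    β-from-next v with v Fin.≟ next (next v)
    ... | yes eq = ⊥-elim (next²≢id v (sym eq))
    ... | no _ = refl

    β-prev : ∀ v → β v (prev v) ≡ E (toℕ (prev v))
    β-prev v = subst (λ w → β w (prev v) ≡ E (toℕ (prev v))) (next-prev v) (β-from-next (prev v))

    colours-at : ∀ v → Consecutive₃ (E (toℕ (prev v))) (α v) (E (toℕ v))
    colours-at v = subst (λ w → Consecutive₃ (E (toℕ (prev v))) (α w) (E (toℕ w))) (next-prev v)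
                         (proj₂ (links (prev v)))

    β-cases : ∀ v u → T (cycleAdj N v u) → β v u ≡ E (toℕ (prev v)) ⊎ β v u ≡ E (toℕ v)
    β-cases v u adj with adjacent→ v u adj
    ... | inj₁ refl = inj₂ (β-next v)
    ... | inj₂ refl = inj₁ (trans (β-from-next u) (cong (E ∘ toℕ) (next⇒prev {next u} refl)))

    β-sym : ∀ u v → T (cycleAdj N u v) → β u v ≡ β v u
    β-sym u v adj with adjacent→ u v adj
    ... | inj₁ refl = trans (β-next u) (sym (β-from-next u))
    ... | inj₂ refl = trans (β-from-next v) (sym (β-next v))

    β-range : ∀ u v → T (cycleAdj N u v) → 1 ≤ β u v × β u v ≤ t
    β-range u v adj with β-cases u v adj
    ... | inj₁ eq = subst (λ c → 1 ≤ c × c ≤ t) (sym eq) (E-range _ (toℕ<n (prev u)))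
    ... | inj₂ eq = subst (λ c → 1 ≤ c × c ≤ t) (sym eq) (E-range _ (toℕ<n u))

    adjacent-vertices : ∀ u v → T (cycleAdj N u v) → α u ≢ α v
    adjacent-vertices u v adj with adjacent→ u v adj
    ... | inj₁ refl = proj₁ (links u)
    ... | inj₂ refl = proj₁ (links v) ∘ sym

    adjacent-edges : ∀ u v w → T (cycleAdj N u v) → T (cycleAdj N u w) → v ≢ w → β u v ≢ β u w
    adjacent-edges u v w adj-v adj-w v≢w with adjacent→ u v adj-v | adjacent→ u w adj-w
    ... | inj₁ refl | inj₁ refl = ⊥-elim (v≢w refl)
    ... | inj₂ u≡v⁺ | inj₂ u≡w⁺ = ⊥-elim (v≢w (next-injective (trans (sym u≡v⁺) u≡w⁺)))
    ... | inj₁ refl | inj₂ refl = λ eq → Consecutive₃.x≢z (proj₂ (links w))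
                                    (sym (trans (sym (β-next (next w))) (trans eq (β-from-next w))))
    ... | inj₂ refl | inj₁ refl = λ eq → Consecutive₃.x≢z (proj₂ (links v))
                                    (trans (sym (β-from-next v)) (trans eq (β-next (next v))))

    incident : ∀ u v → T (cycleAdj N u v) → α u ≢ β u v
    incident u v adj with β-cases u v adj
    ... | inj₁ eq = Consecutive₃.x≢y (colours-at u) ∘ sym ∘ (λ e → trans e eq)
    ... | inj₂ eq = Consecutive₃.y≢z (colours-at u) ∘ (λ e → trans e eq)

    colouring : IntervalTotalColoring (cycleAdj N) t
    colouring = record
      { α = α
      ; β = β
      ; β-sym = β-sym
      ; α-range = λ v → A-range (toℕ v) (toℕ<n v)
      ; β-range = β-range
      ; adj-vertices = adjacent-vertices
      ; adj-edges = adjacent-edges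
      ; incident = incident
      ; surj = surj
      ; interval = interval
      }
      where
      surj : ∀ c → 1 ≤ c → c ≤ t → (∃[ v ] α v ≡ c) ⊎ (∃[ u ] ∃[ v ] (T (cycleAdj N u v) × β u v ≡ c))
      surj c 1≤c c≤t with onto c 1≤c c≤t
      ... | i , i<N , inj₁ Ai≡c = inj₁ (fromℕ< i<N , trans (cong A (toℕ-fromℕ< i<N)) Ai≡c)
      ... | i , i<N , inj₂ Ei≡c = inj₂ (fromℕ< i<N , next (fromℕ< i<N) , adjacent-next (fromℕ< i<N) ,
                                        trans (β-next (fromℕ< i<N)) (trans (cong E (toℕ-fromℕ< i<N)) Ei≡c))

      interval : ∀ v → ∃[ a ] (∀ x → ((x ≡ α v ⊎ ∃[ u ] (T (cycleAdj N v u) × x ≡ β v u))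
                                       ⇔ (a ≤ x × x ≤ a + degree (cycleAdj N) v)))
      interval v rewrite degree-cycle v = base , λ x → mk⇔ to from
        where
        open Consecutive₃ (colours-at v)
        to : ∀ {x} → x ≡ α v ⊎ ∃[ u ] (T (cycleAdj N v u) × x ≡ β v u) → InWindow base x
        to (inj₁ refl) = y∈
        to (inj₂ (u , adj , refl)) with β-cases v u adj
        ... | inj₁ eq = subst (InWindow base) (sym eq) x∈
        ... | inj₂ eq = subst (InWindow base) (sym eq) z∈
        from : ∀ {x} → InWindow base x → x ≡ α v ⊎ ∃[ u ] (T (cycleAdj N v u) × x ≡ β v u)
        from x∈ with covers x∈
        ... | inj₁ x≡E⁻ = inj₂ (prev v , adjacent-prev v , trans x≡E⁻ (sym (β-prev v)))
        ... | inj₂ (inj₁ x≡α) = inj₁ x≡α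
        ... | inj₂ (inj₂ x≡E) = inj₂ (next v , adjacent-next v , trans x≡E (sym (β-next v)))

module Bounds (m : ℕ) {t : ℕ} (c : IntervalTotalColoring (cycleAdj (3 + m)) t) where
  open Cycle m
  open IntervalTotalColoring c

  lo : Fin N → ℕ
  lo v = proj₁ (interval v)

  in-window : ∀ v {x} → x ≡ α v ⊎ ∃[ u ] (T (cycleAdj N v u) × x ≡ β v u) → InWindow (lo v) x
  in-window v {x} coloured =
    subst (λ d → lo v ≤ x × x ≤ lo v + d) (degree-cycle v) (Equivalence.to (proj₂ (interval v) x) coloured)

  vertex : ℕ → Fin N
  vertex i = i mod N

  A E a : ℕ → ℕ
  A i = α (vertex i)
  E i = β (vertex i) (vertex (suc i))
  a i = lo (vertex i)

  succ-adjacent : ∀ i → T (cycleAdj N (vertex i) (vertex (suc i)))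
  succ-adjacent i = subst (T ∘ cycleAdj N (vertex i)) (sym (mod-suc i)) (adjacent-next (vertex i))

  succ-adjacent′ : ∀ i → T (cycleAdj N (vertex (suc i)) (vertex i))
  succ-adjacent′ i = adjacent-sym (vertex i) (vertex (suc i)) (succ-adjacent i)

  E-back : ∀ i → β (vertex (suc i)) (vertex i) ≡ E i
  E-back i = sym (β-sym (vertex i) (vertex (suc i)) (succ-adjacent i))

  two-steps-apart : ∀ i → vertex i ≢ vertex (suc (suc i))
  two-steps-apart i eq = next²≢id (vertex i) (sym (trans eq (trans (mod-suc (suc i)) (cong next (mod-suc i)))))

  E-in-window : ∀ i → InWindow (a i) (E i)
  E-in-window i = in-window (vertex i) (inj₂ (vertex (suc i) , succ-adjacent i , refl))

  E-in-next-window : ∀ i → InWindow (a (suc i)) (E i)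
  E-in-next-window i = in-window (vertex (suc i)) (inj₂ (vertex i , succ-adjacent′ i , sym (E-back i)))

  rise : ∀ i → a (suc i) ≤ 2 + a i
  rise i = ≤-trans (proj₁ (E-in-next-window i)) (subst (E i ≤_) (+-comm (a i) 2) (proj₂ (E-in-window i)))

  fall : ∀ i → a i ≤ 2 + a (suc i)
  fall i = ≤-trans (proj₁ (E-in-window i)) (subst (E i ≤_) (+-comm (a (suc i)) 2) (proj₂ (E-in-next-window i)))

  A≢A⁺ : ∀ i → A i ≢ A (suc i)
  A≢A⁺ i = adj-vertices (vertex i) (vertex (suc i)) (succ-adjacent i)

  A≢E : ∀ i → A i ≢ E i
  A≢E i = incident (vertex i) (vertex (suc i)) (succ-adjacent i)

  E≢A⁺ : ∀ i → E i ≢ A (suc i)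
  E≢A⁺ i eq = incident (vertex (suc i)) (vertex i) (succ-adjacent′ i) (trans (sym eq) (sym (E-back i)))

  E≢E⁺ : ∀ i → E i ≢ E (suc i)
  E≢E⁺ i eq = adj-edges (vertex (suc i)) (vertex i) (vertex (suc (suc i))) (succ-adjacent′ i) (succ-adjacent (suc i))
                        (two-steps-apart i) (trans (E-back i) eq)

  -- both edges at vertex i + 1 would get the colour 2 + a (i + 1)
  no-valley : ∀ i → a i ≡ 2 + a (suc i) → a (suc (suc i)) ≢ 2 + a (suc i)
  no-valley i left right = E≢E⁺ i (trans (top (E-in-window i) (E-in-next-window i) left)
                                         (sym (top (E-in-next-window (suc i)) (E-in-window (suc i)) right)))
    where
    top : ∀ {x b c} → InWindow b x → InWindow c x → b ≡ 2 + c → x ≡ 2 + c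
    top {c = c} (b≤x , _) (_ , x≤c+2) refl = ≤-antisym (≤-trans x≤c+2 (≤-reflexive (+-comm c 2))) b≤x

  colour-window : ∀ k → 1 ≤ k → k ≤ t → ∃[ i ] i < N × InWindow (a i) k
  colour-window k 1≤k k≤t with surj k 1≤k k≤t
  ... | inj₁ (v , refl) = toℕ v , toℕ<n v ,
          subst (λ w → InWindow (lo w) k) (sym (mod-toℕ v)) (in-window v (inj₁ refl))
  ... | inj₂ (u , v , adj , refl) = toℕ u , toℕ<n u ,
          subst (λ w → InWindow (lo w) k) (sym (mod-toℕ u)) (in-window u (inj₂ (v , adj , refl)))

  at-least-3 : 3 ≤ t
  at-least-3 = three-distinct⇒3≤t (α-range v)
    (β-range v (next v) (adjacent-next v)) (β-range v (prev v) (adjacent-prev v))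
    (incident v (next v) (adjacent-next v)) (incident v (prev v) (adjacent-prev v))
    (adj-edges v (next v) (prev v) (adjacent-next v) (adjacent-prev v) (next≢prev v))
    where v = Fin.zero

  at-most-N+2 : 1 ≤ t → t ≤ N + 2
  at-most-N+2 1≤t with colour-window 1 ≤-refl 1≤t | colour-window t 1≤t ≤-refl
  ... | p , p<N , ap≤1 , _ | q , q<N , _ , t≤aq+2 = ≤-trans t≤aq+2 (+-monoˡ-≤ 2 (≤-pred (begin
        suc (a q)  ≤⟨ oscillation p<N q<N ⟩
        N + a p    ≤⟨ +-monoʳ-≤ N ap≤1 ⟩
        N + 1      ≡⟨ +-comm N 1 ⟩
        suc N      ∎)))
    where
    open Oscillation a rise fall no-valley (λ i → cong lo (mod-periodic i))
    open ≤-Reasoning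

  three⇒3∣N : t ≡ 3 → 3 ∣ N
  three⇒3∣N refl = ThreeColours.3∣period (λ i → α-range (vertex i))
    (λ i → β-range (vertex i) (vertex (suc i)) (succ-adjacent i))
    A≢A⁺ A≢E E≢A⁺ E≢E⁺ (λ i → cong α (mod-periodic i))

vertex-colour edge-colour : ℕ → ℕ
vertex-colour 0 = 1
vertex-colour 1 = 3
vertex-colour 2 = 2
vertex-colour _ = 4
edge-colour 0 = 2
edge-colour 1 = 1
edge-colour 2 = 3
edge-colour _ = 3

Transition : ℕ → ℕ → Set
Transition = Link vertex-colour edge-colour

0→1 : Transition 0 1
0→1 = (λ ()) , consecutive 1 (# 1) (# 2) (# 0) refl refl refl (λ ()) (λ ()) (λ ())

1→2 : Transition 1 2
1→2 = (λ ()) , consecutive 1 (# 0) (# 1) (# 2) refl refl refl (λ ()) (λ ()) (λ ())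

2→0 : Transition 2 0
2→0 = (λ ()) , consecutive 1 (# 2) (# 0) (# 1) refl refl refl (λ ()) (λ ()) (λ ())

0→3 : Transition 0 3
0→3 = (λ ()) , consecutive 2 (# 0) (# 2) (# 1) refl refl refl (λ ()) (λ ()) (λ ())

3→0 : Transition 3 0
3→0 = (λ ()) , consecutive 1 (# 2) (# 0) (# 1) refl refl refl (λ ()) (λ ()) (λ ())

in-range : ∀ {x t} → T (1 ≤ᵇ x) → T (x ≤ᵇ t) → 1 ≤ x × x ≤ t
in-range {x} {t} p q = ≤ᵇ⇒≤ 1 x p , ≤ᵇ⇒≤ x t q

state-colours : ∀ x → (1 ≤ vertex-colour x × vertex-colour x ≤ 4) × (1 ≤ edge-colour x × edge-colour x ≤ 4)
state-colours 0 = in-range tt tt , in-range tt tt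
state-colours 1 = in-range tt tt , in-range tt tt
state-colours 2 = in-range tt tt , in-range tt tt
state-colours (suc (suc (suc _))) = in-range tt tt , in-range tt tt

cycle3 : ℕ → ℕ
cycle3 0 = 0
cycle3 1 = 1
cycle3 2 = 2
cycle3 (suc (suc (suc i))) = cycle3 i

cycle3-transition : ∀ i → Transition (cycle3 i) (cycle3 (suc i))
cycle3-transition 0 = 0→1
cycle3-transition 1 = 1→2
cycle3-transition 2 = 2→0
cycle3-transition (suc (suc (suc i))) = cycle3-transition i

cycle3-colours : ∀ i → (1 ≤ vertex-colour (cycle3 i) × vertex-colour (cycle3 i) ≤ 3)
                     × (1 ≤ edge-colour (cycle3 i) × edge-colour (cycle3 i) ≤ 3)
cycle3-colours 0 = in-range tt tt , in-range tt tt
cycle3-colours 1 = in-range tt tt , in-range tt tt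
cycle3-colours 2 = in-range tt tt , in-range tt tt
cycle3-colours (suc (suc (suc i))) = cycle3-colours i

cycle3-last : ∀ q → cycle3 (2 + q * 3) ≡ 2
cycle3-last zero = refl
cycle3-last (suc q) = cycle3-last q

three-colouring : ∀ m → 3 ∣ 3 + m → IntervalTotalColoring (cycleAdj (3 + m)) 3
three-colouring m (divides (suc q) 3+m≡) =
  FromPattern.colouring 3 (vertex-colour ∘ cycle3) (edge-colour ∘ cycle3)
    (λ i _ → proj₁ (cycle3-colours i)) (λ i _ → proj₂ (cycle3-colours i))
    (around (Link (vertex-colour ∘ cycle3) (edge-colour ∘ cycle3)) (λ j _ → cycle3-transition j) wrap) onto
  where
  open Cycle m
  wrap : Transition (cycle3 (2 + m)) 0
  wrap rewrite +-cancelˡ-≡ 3 m (q * 3) 3+m≡ | cycle3-last q = 2→0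
  onto : ∀ c → 1 ≤ c → c ≤ 3 → ∃[ i ] i < N × (vertex-colour (cycle3 i) ≡ c ⊎ edge-colour (cycle3 i) ≡ c)
  onto 1 _ _ = 0 , s≤s z≤n , inj₁ refl
  onto 2 _ _ = 0 , s≤s z≤n , inj₂ refl
  onto 3 _ _ = 1 , s≤s (s≤s z≤n) , inj₁ refl
  onto (suc (suc (suc (suc _)))) _ (s≤s (s≤s (s≤s ())))

alternate : ℕ → ℕ
alternate 0 = 0
alternate 1 = 3
alternate (suc (suc i)) = alternate i

alternate-transition : ∀ i → Transition (alternate i) (alternate (suc i))
alternate-transition 0 = 0→3
alternate-transition 1 = 3→0
alternate-transition (suc (suc i)) = alternate-transition i

alternate-odd : ∀ k → alternate (suc (2 * k)) ≡ 3
alternate-odd zero = refl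
alternate-odd (suc k) rewrite +-suc k (k + 0) = alternate-odd k

triangle-then-alternate : ℕ → ℕ
triangle-then-alternate (suc (suc (suc i))) = alternate i
triangle-then-alternate i = cycle3 i

triangle-then-alternate-transition : ∀ i → Transition (triangle-then-alternate i) (triangle-then-alternate (suc i))
triangle-then-alternate-transition 0 = 0→1
triangle-then-alternate-transition 1 = 1→2
triangle-then-alternate-transition 2 = 2→0
triangle-then-alternate-transition (suc (suc (suc i))) = alternate-transition i

even-colouring : ∀ k → IntervalTotalColoring (cycleAdj (3 + suc (2 * k))) 4
even-colouring k =
  FromPattern.colouring 4 (vertex-colour ∘ alternate) (edge-colour ∘ alternate)
    (λ i _ → proj₁ (state-colours (alternate i))) (λ i _ → proj₂ (state-colours (alternate i)))
    (around (Link (vertex-colour ∘ alternate) (edge-colour ∘ alternate)) (λ j _ → alternate-transition j) wrap) onto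
  where
  open Cycle (suc (2 * k))
  wrap : Transition (alternate (suc (2 * k))) 0
  wrap rewrite alternate-odd k = 3→0
  onto : ∀ c → 1 ≤ c → c ≤ 4 →
         ∃[ i ] i < N × (vertex-colour (alternate i) ≡ c ⊎ edge-colour (alternate i) ≡ c)
  onto 1 _ _ = 0 , s≤s z≤n , inj₁ refl
  onto 2 _ _ = 0 , s≤s z≤n , inj₂ refl
  onto 3 _ _ = 1 , s≤s (s≤s z≤n) , inj₂ refl
  onto 4 _ _ = 1 , s≤s (s≤s z≤n) , inj₁ refl
  onto (suc (suc (suc (suc (suc _))))) _ (s≤s (s≤s (s≤s (s≤s ()))))

odd-colouring : ∀ k → IntervalTotalColoring (cycleAdj (3 + 2 * suc k)) 4
odd-colouring k =
  FromPattern.colouring 4 (vertex-colour ∘ triangle-then-alternate) (edge-colour ∘ triangle-then-alternate)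
    (λ i _ → proj₁ (state-colours (triangle-then-alternate i)))
    (λ i _ → proj₂ (state-colours (triangle-then-alternate i)))
    (around (Link (vertex-colour ∘ triangle-then-alternate) (edge-colour ∘ triangle-then-alternate))
            (λ j _ → triangle-then-alternate-transition j) wrap) onto
  where
  open Cycle (2 * suc k)
  wrap : Transition (triangle-then-alternate (2 + 2 * suc k)) 0
  wrap rewrite +-suc k (k + 0) | alternate-odd k = 3→0
  onto : ∀ c → 1 ≤ c → c ≤ 4 → ∃[ i ] i < N × (vertex-colour (triangle-then-alternate i) ≡ c
                                                ⊎ edge-colour (triangle-then-alternate i) ≡ c)
  onto 1 _ _ = 0 , s≤s z≤n , inj₁ refl
  onto 2 _ _ = 0 , s≤s z≤n , inj₂ refl
  onto 3 _ _ = 1 , s≤s (s≤s z≤n) , inj₁ refl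
  onto 4 _ _ = 4 , s≤s (s≤s (s≤s (*-monoʳ-≤ 2 (s≤s z≤n)))) , inj₁ refl
  onto (suc (suc (suc (suc (suc _))))) _ (s≤s (s≤s (s≤s (s≤s ()))))

parity : ∀ n → ∃[ k ] (n ≡ 2 * k ⊎ n ≡ suc (2 * k))
parity zero = 0 , inj₁ refl
parity (suc n) with parity n
... | k , inj₁ refl = k , inj₂ refl
... | k , inj₂ refl = suc k , inj₁ (sym (*-suc 2 k))

four-colouring : ∀ m → ¬ 3 ∣ 3 + m → IntervalTotalColoring (cycleAdj (3 + m)) 4
four-colouring m 3∤ with parity m
... | zero , inj₁ refl = ⊥-elim (3∤ (divides 1 refl))
... | suc k , inj₁ refl = odd-colouring k
... | k , inj₂ refl = even-colouring k

-- The windows of the vertices 0 < i < w climb by 2 per step ([2i, 2i + 2]), vertex w takes the top colour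
-- N + 2, and the windows of the remaining d vertices descend again ([2r + 1, 2r + 3] for vertex N − r).
module MaxColouring (m w d : ℕ) (N≡w+d : 3 + m ≡ w + d) (balanced : d ≡ w ⊎ w ≡ suc d) where
  open Cycle m

  A E : ℕ → ℕ
  A i with <-cmp i w
  ... | tri< _ _ _ = suc (2 * i)
  ... | tri≈ _ _ _ = N + 2
  ... | tri> _ _ _ = 2 + 2 * (N ∸ i)
  E i with i <? w
  ... | yes _ = 2 + 2 * i
  ... | no _ = suc (2 * (N ∸ i))

  distance : ∀ {i r} → i + r ≡ N → N ∸ i ≡ r
  distance {i} {r} i+r≡N = trans (cong (_∸ i) (sym i+r≡N)) (m+n∸m≡n i r)

  A-rising : ∀ {i} → i < w → A i ≡ suc (2 * i)
  A-rising {i} i<w with <-cmp i w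
  ... | tri< _ _ _ = refl
  ... | tri≈ i≮w _ _ = ⊥-elim (i≮w i<w)
  ... | tri> i≮w _ _ = ⊥-elim (i≮w i<w)

  A-top : A w ≡ N + 2
  A-top with <-cmp w w
  ... | tri< _ w≢w _ = ⊥-elim (w≢w refl)
  ... | tri≈ _ _ _ = refl
  ... | tri> _ w≢w _ = ⊥-elim (w≢w refl)

  A-falling : ∀ {i r} → w < i → i + r ≡ N → A i ≡ 2 + 2 * r
  A-falling {i} {r} w<i i+r≡N with <-cmp i w
  ... | tri< _ _ w≮i = ⊥-elim (w≮i w<i)
  ... | tri≈ _ _ w≮i = ⊥-elim (w≮i w<i)
  ... | tri> _ _ _ = cong (λ k → 2 + 2 * k) (distance {i} {r} i+r≡N)

  E-rising : ∀ {i} → i < w → E i ≡ 2 + 2 * i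
  E-rising {i} i<w with i <? w
  ... | yes _ = refl
  ... | no i≮w = ⊥-elim (i≮w i<w)

  E-falling : ∀ {i r} → w ≤ i → i + r ≡ N → E i ≡ suc (2 * r)
  E-falling {i} {r} w≤i i+r≡N with i <? w
  ... | yes i<w = ⊥-elim (<⇒≱ i<w w≤i)
  ... | no _ = cong (λ k → suc (2 * k)) (distance {i} {r} i+r≡N)

  d≤w : d ≤ w
  d≤w = [ ≤-reflexive , (λ { refl → n≤1+n d }) ]′ balanced

  w≤1+d : w ≤ suc d
  w≤1+d = [ (λ { refl → n≤1+n d }) , ≤-reflexive ]′ balanced

  2w-even : d ≡ w → 2 * w ≡ N
  2w-even d≡w = trans (twice w) (trans (cong (w +_) (sym d≡w)) (sym N≡w+d))

  2w-odd : w ≡ suc d → 2 * w ≡ suc N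
  2w-odd w≡1+d = trans (twice w) (trans (cong (w +_) w≡1+d) (trans (+-suc w d) (cong suc (sym N≡w+d))))

  2d+1-odd : w ≡ suc d → suc (2 * d) ≡ N
  2d+1-odd w≡1+d = suc-injective (trans (sym (*-suc 2 d)) (trans (cong (2 *_) (sym w≡1+d)) (2w-odd w≡1+d)))

  2w≤1+N : 2 * w ≤ suc N
  2w≤1+N = [ (λ d≡w → ≤-trans (≤-reflexive (2w-even d≡w)) (n≤1+n N)) , ≤-reflexive ∘ 2w-odd ]′ balanced

  0<d : 0 < d
  0<d = n≢0⇒n>0 λ d≡0 → N≰1 (subst (λ k → N ≤ suc k + k) d≡0
                                     (≤-trans (≤-reflexive N≡w+d) (+-monoˡ-≤ d w≤1+d)))
    where N≰1 : ¬ N ≤ 1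
          N≰1 (s≤s ())

  w<N : w < N
  w<N = subst (w <_) (sym N≡w+d) (m<m+n w 0<d)

  rising-short : ∀ {i} → i < w → suc (2 * i) ≤ N
  rising-short {i} i<w = ≤-pred (begin
    2 + 2 * i   ≡⟨ *-suc 2 i ⟨
    2 * suc i   ≤⟨ *-monoʳ-≤ 2 i<w ⟩
    2 * w       ≤⟨ 2w≤1+N ⟩
    suc N       ∎)
    where open ≤-Reasoning

  falling-short : ∀ {i r} → w ≤ i → i + r ≡ N → 2 * r ≤ N
  falling-short {i} {r} w≤i i+r≡N = begin
    2 * r    ≡⟨ twice r ⟩
    r + r    ≤⟨ +-monoˡ-≤ r (≤-trans r≤d (≤-trans d≤w w≤i)) ⟩
    i + r    ≡⟨ i+r≡N ⟩
    N        ∎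
    where
    open ≤-Reasoning
    r≤d : r ≤ d
    r≤d = +-cancelˡ-≤ w r d (≤-trans (+-monoˡ-≤ r w≤i) (≤-reflexive (trans i+r≡N N≡w+d)))

  below-top : ∀ k {x} → k ≤ 2 → x ≤ N → k + x ≤ N + 2
  below-top k {x} k≤2 x≤N = subst (k + x ≤_) (+-comm 2 N) (+-mono-≤ k≤2 x≤N)

  colour : ∀ {c k} → c ≡ suc k → suc k ≤ N + 2 → 1 ≤ c × c ≤ N + 2
  colour refl k<N+2 = s≤s z≤n , k<N+2

  position : ∀ i → i < w ⊎ i ≡ w ⊎ w < i
  position i with <-cmp i w
  ... | tri< i<w _ _ = inj₁ i<w
  ... | tri≈ _ i≡w _ = inj₂ (inj₁ i≡w)
  ... | tri> _ _ w<i = inj₂ (inj₂ w<i)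

  A-range : ∀ i → i < N → 1 ≤ A i × A i ≤ N + 2
  A-range i i<N with position i
  ... | inj₁ i<w = colour (A-rising i<w) (below-top 1 (s≤s z≤n) (<⇒≤ (rising-short i<w)))
  ... | inj₂ (inj₁ refl) = colour A-top ≤-refl
  ... | inj₂ (inj₂ w<i) with r , i+r≡N ← m≤n⇒∃[o]m+o≡n (<⇒≤ i<N) =
    colour (A-falling w<i i+r≡N) (below-top 2 ≤-refl (falling-short (<⇒≤ w<i) i+r≡N))

  E-range : ∀ i → i < N → 1 ≤ E i × E i ≤ N + 2
  E-range i i<N with position i
  ... | inj₁ i<w = colour (E-rising i<w) (below-top 2 ≤-refl (<⇒≤ (rising-short i<w)))
  ... | inj₂ w≤i′ with r , i+r≡N ← m≤n⇒∃[o]m+o≡n (<⇒≤ i<N) =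
    colour (E-falling w≤i i+r≡N) (below-top 1 (s≤s z≤n) (falling-short w≤i i+r≡N))
    where
    w≤i : w ≤ i
    w≤i = [ ≤-reflexive ∘ sym , <⇒≤ ]′ w≤i′

  link-rising : ∀ j → suc j < w → Link A E j (suc j)
  link-rising j j+1<w =
    (λ eq → m≢1+n+m (suc (2 * j)) {1} (trans (sym (A-rising j<w)) (trans eq A-next))) ,
    consecutive (2 + 2 * j) (# 0) (# 1) (# 2) (E-rising j<w) A-next
                (trans (E-rising j+1<w) (cong (2 +_) (*-suc 2 j))) (λ ()) (λ ()) (λ ())
    where
    j<w : j < w
    j<w = <-trans (n<1+n j) j+1<w
    A-next : A (suc j) ≡ 1 + (2 + 2 * j)
    A-next = trans (A-rising j+1<w) (cong suc (*-suc 2 j))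

  link-top : ∀ j → suc j ≡ w → Link A E j w
  link-top j j+1≡w = A-distinct , [ even , odd ]′ balanced
    where
    j<w : j < w
    j<w = subst (j <_) j+1≡w (n<1+n j)
    E-before : E j ≡ 2 * w
    E-before = trans (E-rising j<w) (trans (sym (*-suc 2 j)) (cong (2 *_) j+1≡w))
    E-top : E w ≡ suc (2 * d)
    E-top = E-falling ≤-refl (sym N≡w+d)
    A-top′ : A w ≡ 2 + N
    A-top′ = trans A-top (+-comm N 2)
    A-distinct : A j ≢ A w
    A-distinct = <⇒≢ (begin-strict
      A j          ≡⟨ A-rising j<w ⟩
      suc (2 * j)  <⟨ n<1+n _ ⟩
      2 + 2 * j    ≡⟨ E-rising j<w ⟨
      E j          ≤⟨ proj₂ (E-range j (<-trans j<w w<N)) ⟩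
      N + 2        ≡⟨ A-top ⟨
      A w          ∎)
      where open ≤-Reasoning
    even : d ≡ w → Consecutive₃ (E j) (A w) (E w)
    even d≡w = consecutive N (# 0) (# 2) (# 1) (trans E-before (2w-even d≡w)) A-top′
      (trans E-top (cong suc (trans (cong (2 *_) d≡w) (2w-even d≡w)))) (λ ()) (λ ()) (λ ())
    odd : w ≡ suc d → Consecutive₃ (E j) (A w) (E w)
    odd w≡1+d = consecutive N (# 1) (# 2) (# 0) (trans E-before (2w-odd w≡1+d)) A-top′
      (trans E-top (2d+1-odd w≡1+d)) (λ ()) (λ ()) (λ ())

  link-falling : ∀ j → w ≤ j → suc j < N → Link A E j (suc j)
  link-falling j w≤j j+1<N with o , j+2+o≡N ← m≤n⇒∃[o]m+o≡n j+1<N =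
    (λ eq → <⇒≢ A-next<A-here (sym eq)) ,
    consecutive (suc (2 * suc o)) (# 2) (# 1) (# 0) E-here A-next E-next (λ ()) (λ ()) (λ ())
    where
    here : j + suc (suc o) ≡ N
    here = trans (+-suc j (suc o)) (trans (cong suc (+-suc j o)) j+2+o≡N)
    there : suc j + suc o ≡ N
    there = trans (cong suc (+-suc j o)) j+2+o≡N
    E-here : E j ≡ 2 + suc (2 * suc o)
    E-here = trans (E-falling w≤j here) (cong suc (*-suc 2 (suc o)))
    A-next : A (suc j) ≡ 1 + suc (2 * suc o)
    A-next = A-falling (s≤s w≤j) there
    E-next : E (suc j) ≡ suc (2 * suc o)
    E-next = E-falling (≤-trans w≤j (n≤1+n j)) there
    A-next<A-here : A (suc j) < A j
    A-next<A-here with m≤n⇒m<n∨m≡n w≤j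
    ... | inj₁ w<j = begin-strict
      A (suc j)             ≡⟨ A-next ⟩
      2 + 2 * suc o         <⟨ +-monoʳ-< 2 (*-monoʳ-< 2 (n<1+n (suc o))) ⟩
      2 + 2 * suc (suc o)   ≡⟨ A-falling w<j here ⟨
      A j                   ∎
      where open ≤-Reasoning
    ... | inj₂ w≡j = begin-strict
      A (suc j)             ≡⟨ A-next ⟩
      2 + 2 * suc o         <⟨ n<1+n _ ⟩
      3 + 2 * suc o         ≡⟨ E-here ⟨
      E j                   ≤⟨ proj₂ (E-range j (<-trans (n<1+n j) j+1<N)) ⟩
      N + 2                 ≡⟨ subst (λ v → A v ≡ N + 2) w≡j A-top ⟨
      A j                   ∎
      where open ≤-Reasoning

  link-wrap : Link A E (2 + m) 0
  link-wrap = A-distinct ,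
    consecutive 1 (# 2) (# 0) (# 1) (E-falling w≤2+m (+-comm (2 + m) 1)) (A-rising 0<w) (E-rising 0<w)
                (λ ()) (λ ()) (λ ())
    where
    0<w : 0 < w
    0<w = <-≤-trans 0<d d≤w
    w≤2+m : w ≤ 2 + m
    w≤2+m = ≤-pred w<N
    A-distinct : A (2 + m) ≢ A 0
    A-distinct eq with m≤n⇒m<n∨m≡n w≤2+m
    ... | inj₁ w<2+m with () ← trans (sym (A-falling w<2+m (+-comm (2 + m) 1))) (trans eq (A-rising 0<w))
    ... | inj₂ w≡2+m with () ← trans (sym (subst (λ v → A v ≡ N + 2) w≡2+m A-top)) (trans eq (A-rising 0<w))

  rising-onto : ∀ {c} → 1 ≤ c → c ≤ 2 * w → ∃[ i ] i < N × (A i ≡ c ⊎ E i ≡ c)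
  rising-onto {c} 1≤c c≤2w with parity c
  ... | zero , inj₁ refl with () ← 1≤c
  ... | suc k , inj₁ refl = k , <-trans k<w w<N , inj₂ (trans (E-rising k<w) (sym (*-suc 2 k)))
    where k<w : k < w
          k<w = *-cancelˡ-≤ 2 c≤2w
  ... | k , inj₂ refl = k , <-trans k<w w<N , inj₁ (A-rising k<w)
    where k<w : k < w
          k<w = *-cancelˡ-< 2 k w c≤2w

  top-onto : ∀ {c} → 2 * w < c → c ≤ N + 2 → ∃[ i ] i < N × (A i ≡ c ⊎ E i ≡ c)
  top-onto {c} 2w<c c≤N+2 with c ≟ N + 2
  ... | yes refl = w , w<N , inj₁ A-top
  ... | no c≢N+2 = w , w<N , inj₂ ([ even , odd ]′ balanced)
    where
    c≤1+N : c ≤ suc N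
    c≤1+N = ≤-pred (subst (c <_) (+-comm N 2) (≤∧≢⇒< c≤N+2 c≢N+2))
    even : d ≡ w → E w ≡ c
    even d≡w = trans (E-falling ≤-refl (sym N≡w+d))
      (trans (cong suc (trans (cong (2 *_) d≡w) (2w-even d≡w)))
             (≤-antisym (subst (λ x → suc x ≤ c) (2w-even d≡w) 2w<c) c≤1+N))
    odd : w ≡ suc d → E w ≡ c
    odd w≡1+d = ⊥-elim (<-irrefl refl (<-≤-trans (subst (_< c) (2w-odd w≡1+d) 2w<c) c≤1+N))

  colouring : IntervalTotalColoring (cycleAdj N) (N + 2)
  colouring = FromPattern.colouring (N + 2) A E A-range E-range (around (Link A E) step link-wrap) onto
    where
    step : ∀ j → suc j < N → Link A E j (suc j)
    step j j+1<N with position (suc j)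
    ... | inj₁ j+1<w = link-rising j j+1<w
    ... | inj₂ (inj₁ j+1≡w) = subst (Link A E j) (sym j+1≡w) (link-top j j+1≡w)
    ... | inj₂ (inj₂ w<j+1) = link-falling j (≤-pred w<j+1) j+1<N
    onto : ∀ c → 1 ≤ c → c ≤ N + 2 → ∃[ i ] i < N × (A i ≡ c ⊎ E i ≡ c)
    onto c 1≤c c≤N+2 with c ≤? 2 * w
    ... | yes c≤2w = rising-onto 1≤c c≤2w
    ... | no c≰2w = top-onto (≰⇒> c≰2w) c≤N+2

maximal-colouring : ∀ m → IntervalTotalColoring (cycleAdj (3 + m)) (3 + m + 2)
maximal-colouring m with parity (3 + m)
... | k , inj₁ N≡2k = MaxColouring.colouring m k k (trans N≡2k (twice k)) (inj₁ refl)
... | k , inj₂ N≡1+2k = MaxColouring.colouring m (suc k) k (trans N≡1+2k (cong suc (twice k))) (inj₂ refl)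

theorem8 : ∀ (n : ℕ) → 3 ≤ n →
    InTAny (cycleAdj n)
    × (3 ∣ n → IsMinT (cycleAdj n) 3)
    × (¬ (3 ∣ n) → IsMinT (cycleAdj n) 4)
    × IsMaxT (cycleAdj n) (n + 2)
theorem8 (suc (suc (suc m))) (s≤s (s≤s (s≤s z≤n))) =
  (3 + m + 2 , s≤s z≤n , maximal-colouring m) ,
  (λ 3∣n → (s≤s z≤n , three-colouring m 3∣n) , λ t (_ , c) → Bounds.at-least-3 m c) ,
  (λ 3∤n → (s≤s z≤n , four-colouring m 3∤n) ,
           λ t (_ , c) → ≤∧≢⇒< (Bounds.at-least-3 m c) (3∤n ∘ Bounds.three⇒3∣N m c ∘ sym)) ,
  ((s≤s z≤n , maximal-colouring m) , λ t (1≤t , c) → Bounds.at-most-N+2 m c 1≤t)
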